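{- Let $G$ be a simple graph and suppose $\phi$ is an orientable embedding of $G$ of type $(a_1, \dotsc, a_i)$ with $(a_1-3) + \dots + (a_i-3) \leq 5$. Then $\phi$ is a minimum genus embedding of $G$.
   Context: Embeddings are cellular embeddings in closed orientable surfaces; the length of a face is the number of corners on its boundary walk. An embedding is of type $(a_1, \dotsc, a_i)$, with $a_1 \geq \dots \geq a_i > 3$, if it has exactly $i$ nontriangular faces, of lengths $a_1,\dotsc,a_i$, and all other faces are triangles. A minimum genus embedding is one in an orientable surface of smallest possible genus among all embeddings of $G$. -}

module Defs where

open import Data.Nat using (ℕ; zero; suc; _+_; _*_; _∸_; _≤_; _<_; _<ᵇ_)
open import Data.Bool using (Bool; true; false; _∧_; if_then_else_)
open import Data.Fin using (Fin; toℕ)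
open import Data.Product using (_×_; _,_; ∃; ∃-syntax; Σ)
open import Data.List using (List; []; _∷_; map; length; allFin)
open import Data.Nat.ListAction using (sum)
open import Data.List.Relation.Unary.All using (All)
open import Data.List.Relation.Unary.Any using (Any)
open import Data.List.Relation.Unary.AllPairs using (AllPairs)
open import Data.List.Relation.Binary.Pointwise using (Pointwise)
open import Relation.Binary.PropositionalEquality using (_≡_; _≢_)
open import Relation.Binary.Construct.Closure.ReflexiveTransitive using (Star)
open import Relation.Nullary using (¬_)

iter : {A : Set} → (A → A) → ℕ → A → A
iter f zero    x = x
iter f (suc k) x = f (iter f k x)

record SimpleGraph (n : ℕ) : Set where
  field
    adj   : Fin n → Fin n → Bool
    sym   : ∀ u v → adj u v ≡ adj v u
    loopless : ∀ u → adj u u ≡ false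
open SimpleGraph public

Adj : ∀ {n} → SimpleGraph n → Fin n → Fin n → Set
Adj G u v = adj G u v ≡ true

Connected : ∀ {n} → SimpleGraph n → Set
Connected {n} G = ∀ (u v : Fin n) → Star (Adj G) u v

numEdges : ∀ {n} → SimpleGraph n → ℕ
numEdges {n} G =
  sum (map (λ u → sum (map (λ v → if adj G u v ∧ (toℕ u <ᵇ toℕ v) then 1 else 0)
                           (allFin n)))
           (allFin n))

-- A rotation system (= orientable cellular embedding of a connected graph):
-- for every vertex u, ρ u is a cyclic permutation of the neighbours of u
-- (values of ρ u on non-neighbours are irrelevant).
record Rotation {n : ℕ} (G : SimpleGraph n) : Set where
  field
    ρ      : Fin n → Fin n → Fin n
    closed : ∀ u v → Adj G u v → Adj G u (ρ u v)
    inj    : ∀ u v w → Adj G u v → Adj G u w → ρ u v ≡ ρ u w → v ≡ w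
    cyclic : ∀ u v w → Adj G u v → Adj G u w → ∃[ k ] iter (ρ u) k v ≡ w
open Rotation public

Dart : ℕ → Set
Dart n = Fin n × Fin n

IsDart : ∀ {n} → SimpleGraph n → Dart n → Set
IsDart G (u , v) = Adj G u v

faceStep : ∀ {n} {G : SimpleGraph n} → Rotation G → Dart n → Dart n
faceStep R (u , v) = (v , ρ R v u)

SameFace : ∀ {n} {G : SimpleGraph n} → Rotation G → Dart n → Dart n → Set
SameFace R d e = ∃[ k ] iter (faceStep R) k d ≡ e

FaceLength : ∀ {n} {G : SimpleGraph n} → Rotation G → Dart n → ℕ → Set
FaceLength R d k =
  (1 ≤ k) × (iter (faceStep R) k d ≡ d)
  × (∀ j → 1 ≤ j → j < k → iter (faceStep R) j d ≢ d)

FaceReps : ∀ {n} {G : SimpleGraph n} → Rotation G → List (Dart n) → Set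
FaceReps {G = G} R L =
  All (IsDart G) L
  × AllPairs (λ d e → ¬ SameFace R d e) L
  × (∀ d → IsDart G d → Any (λ e → SameFace R e d) L)

NumFaces : ∀ {n} {G : SimpleGraph n} → Rotation G → ℕ → Set
NumFaces R f = ∃[ L ] FaceReps R L × length L ≡ f

-- genus via Euler's formula  V - E + F = 2 - 2g
HasGenus : ∀ {n} {G : SimpleGraph n} → Rotation G → ℕ → Set
HasGenus {n} {G} R g = ∃[ f ] NumFaces R f × (n + f + 2 * g ≡ 2 + numEdges G)

-- embedding of type (a_1,...,a_i) with Σ (a_j - 3) ≤ 5:
-- the face lengths (one per face) are all ≥ 3 and the excesses over 3 sum to ≤ 5
-- (faces of length 3 contribute 0, faces of length a_j > 3 contribute a_j - 3)
TypeExcessAtMost : ∀ {n} {G : SimpleGraph n} → Rotation G → ℕ → Set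
TypeExcessAtMost R b =
  ∃[ L ] ∃[ ls ] FaceReps R L × Pointwise (FaceLength R) L ls
    × All (3 ≤_) ls × (sum (map (λ a → a ∸ 3) ls) ≤ b)

MinimumGenus : ∀ {n} {G : SimpleGraph n} → Rotation G → Set
MinimumGenus {G = G} R =
  ∀ g (R' : Rotation G) g' → HasGenus R g → HasGenus R' g' → g ≤ g'

-- In a simple graph a face of length ≤ 2 is a digon along an edge whose ends
-- both have degree 1, and such a digon appears in every embedding.  The given
-- embedding has none, so every face of any other embedding (F' faces) has at
-- least 3 corners and 3F' ≤ 2E, while the given one has 2E = 3F + Σ (aᵢ - 3)
-- ≤ 3F + 5.  By Euler's formula a smaller genus g' < g would force F' ≥ F + 2,
-- i.e. 3F + 6 ≤ 2E ≤ 3F + 5.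
module Submission where

open import Defs renaming (sym to adj-sym)
open import Data.Nat using (ℕ; zero; suc; _+_; _*_; _∸_; _≤_; z≤n; s≤s; NonZero; >-nonZero)
open import Data.Nat.Properties
open import Data.Nat.DivMod using (_%_; _/_; m%n<n; m≡m%n+[m/n]*n)
open import Data.Nat.ListAction using (sum)
open import Data.Nat.Tactic.RingSolver using (solve-∀)
open import Data.Fin using (Fin; toℕ; combine)
open import Data.Fin.Properties using (pigeonhole; combine-injective)
open import Data.Product using (∃; ∃-syntax; _×_; _,_)
open import Data.Product.Properties using (,-injectiveˡ; ,-injectiveʳ)
open import Data.Sum using (inj₁; inj₂)
open import Data.List using (List; []; _∷_; _++_; length; map; applyUpTo)
open import Data.List.Properties using (length-++; length-applyUpTo)
open import Data.List.Relation.Unary.All as All using (All; []; _∷_)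
open import Data.List.Relation.Unary.Any using (Any; here; there)
open import Data.List.Relation.Unary.AllPairs as AllPairs using (AllPairs; []; _∷_)
open import Data.List.Relation.Unary.Unique.Propositional using (Unique)
open import Data.List.Relation.Binary.Pointwise using (Pointwise; []; _∷_)
open import Data.List.Relation.Binary.Pointwise.Properties using (Pointwise-length)
open import Data.List.Relation.Binary.Subset.Propositional using (_⊆_)
open import Data.List.Membership.Propositional using (_∈_; find; lose)
open import Data.List.Membership.Propositional.Properties using (∈-++⁺ˡ; ∈-++⁺ʳ; ∈-applyUpTo⁺)
open import Relation.Binary.PropositionalEquality
open import Function using (_∘_)
open import Relation.Nullary using (¬_; contradiction)
open import Data.Empty using (⊥)

module _ {A : Set} (f : A → A) where

  iter-+ : ∀ m n x → iter f (m + n) x ≡ iter f m (iter f n x)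
  iter-+ zero    n x = refl
  iter-+ (suc m) n x = cong f (iter-+ m n x)

  iter-comm : ∀ m n x → iter f m (iter f n x) ≡ iter f n (iter f m x)
  iter-comm m n x = begin
    iter f m (iter f n x) ≡⟨ iter-+ m n x ⟨
    iter f (m + n) x      ≡⟨ cong (λ k → iter f k x) (+-comm m n) ⟩
    iter f (n + m) x      ≡⟨ iter-+ n m x ⟩
    iter f n (iter f m x) ∎
    where open ≡-Reasoning

  iter-fixed : ∀ {x} → f x ≡ x → ∀ k → iter f k x ≡ x
  iter-fixed fx≡x zero    = refl
  iter-fixed fx≡x (suc k) = trans (cong f (iter-fixed fx≡x k)) fx≡x

  iter-∸ : ∀ {i j} x → i ≤ j → iter f j x ≡ iter f i (iter f (j ∸ i) x)
  iter-∸ {i} {j} x i≤j =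
    trans (cong (λ k → iter f k x) (sym (m+[n∸m]≡n i≤j))) (iter-+ i (j ∸ i) x)

  module _ {p x} (period : iter f p x ≡ x) where

    iter-*-period : ∀ k → iter f (k * p) x ≡ x
    iter-*-period zero    = refl
    iter-*-period (suc k) =
      trans (iter-+ p (k * p) x) (trans (cong (iter f p) (iter-*-period k)) period)

    iter-%-period : .{{_ : NonZero p}} → ∀ k → iter f k x ≡ iter f (k % p) x
    iter-%-period k = begin
      iter f k x                               ≡⟨ cong (λ m → iter f m x) (m≡m%n+[m/n]*n k p) ⟩
      iter f (k % p + (k / p) * p) x           ≡⟨ iter-+ (k % p) ((k / p) * p) x ⟩
      iter f (k % p) (iter f ((k / p) * p) x)  ≡⟨ cong (iter f (k % p)) (iter-*-period (k / p)) ⟩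
      iter f (k % p) x                         ∎
      where open ≡-Reasoning

    iter-inverse : .{{_ : NonZero p}} → ∀ k → iter f (k * p ∸ k) (iter f k x) ≡ x
    iter-inverse k = begin
      iter f (k * p ∸ k) (iter f k x) ≡⟨ iter-+ (k * p ∸ k) k x ⟨
      iter f (k * p ∸ k + k) x        ≡⟨ cong (λ m → iter f m x) (m∸n+n≡m (m≤m*n k p)) ⟩
      iter f (k * p) x                ≡⟨ iter-*-period k ⟩
      x                               ∎
      where open ≡-Reasoning

∈⇒deletion : ∀ {A : Set} {x : A} {ys} → x ∈ ys →
  ∃[ zs ] length ys ≡ suc (length zs) × zs ⊆ ys × (∀ {y} → y ∈ ys → y ≢ x → y ∈ zs)
∈⇒deletion {ys = _ ∷ zs} (here refl) =
  zs , refl , there , λ { (here refl) y≢x → contradiction refl y≢x ; (there y∈zs) _ → y∈zs }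
∈⇒deletion {ys = z ∷ _} (there x∈ys) with zs , |ys| , zs⊆ys , keep ← ∈⇒deletion x∈ys =
  z ∷ zs , cong suc |ys| ,
  (λ { (here refl) → here refl ; (there y∈zs) → there (zs⊆ys y∈zs) }) ,
  λ { (here refl) _ → here refl ; (there y∈ys) y≢x → there (keep y∈ys y≢x) }

-- Each x picks a witness in ys, and separation makes this choice injective.
length-≤-of-separated-witnesses : ∀ {A B : Set} (P : A → B → Set) {xs : List A} {ys : List B} →
  AllPairs (λ x x′ → ∀ {y} → y ∈ ys → P x y → P x′ y → ⊥) xs →
  All (λ x → Any (P x) ys) xs → length xs ≤ length ys
length-≤-of-separated-witnesses P [] [] = z≤n
length-≤-of-separated-witnesses P {xs = x ∷ xs} {ys} (sep ∷ seps) (w ∷ ws)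
  with y , y∈ys , Pxy ← find w
  with zs , |ys| , zs⊆ys , keep ← ∈⇒deletion y∈ys =
    subst (suc (length xs) ≤_) (sym |ys|)
      (s≤s (length-≤-of-separated-witnesses P
             (AllPairs.map (λ s {_} y∈zs → s (zs⊆ys y∈zs)) seps)
             (All.zipWith witnessInZs (sep , ws))))
  where
  witnessInZs : ∀ {x′} → (∀ {y′} → y′ ∈ ys → P x y′ → P x′ y′ → ⊥) × Any (P x′) ys →
                Any (P x′) zs
  witnessInZs (s , w′) with y′ , y′∈ys , Px′y′ ← find w′ =
    lose (keep y′∈ys λ { refl → s y∈ys Pxy Px′y′ }) Px′y′

Unique-⊆⇒length-≤ : ∀ {A : Set} {xs ys : List A} → Unique xs → xs ⊆ ys → length xs ≤ length ys
Unique-⊆⇒length-≤ {xs} unique xs⊆ys =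
  length-≤-of-separated-witnesses _≡_
    (AllPairs.map (λ x≢x′ {_} _ x≡y x′≡y → x≢x′ (trans x≡y (sym x′≡y))) unique)
    (All.tabulate xs⊆ys)

sum-excess : ∀ k ls → All (k ≤_) ls → sum ls ≡ k * length ls + sum (map (_∸ k) ls)
sum-excess k []       []          = sym (trans (+-identityʳ (k * 0)) (*-zeroʳ k))
sum-excess k (l ∷ ls) (k≤l ∷ k≤ls) = begin
  l + sum ls
    ≡⟨ cong₂ _+_ (sym (m+[n∸m]≡n k≤l)) (sum-excess k ls k≤ls) ⟩
  (k + (l ∸ k)) + (k * length ls + excess)
    ≡⟨ regroup k (l ∸ k) (length ls) excess ⟩
  k * suc (length ls) + (l ∸ k + excess)
    ∎
  where
  open ≡-Reasoning
  excess : ℕ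
  excess = sum (map (_∸ k) ls)
  regroup : ∀ k a m b → (k + a) + (k * m + b) ≡ k * suc m + (a + b)
  regroup = solve-∀

Pointwise-All⇒All : ∀ {A B : Set} {R : A → B → Set} {P : B → Set} {xs ys} →
  Pointwise R xs ys → All P ys → All (λ x → ∃[ y ] R x y × P y) xs
Pointwise-All⇒All []         []         = []
Pointwise-All⇒All (r ∷ rs)   (p ∷ ps)   = (_ , r , p) ∷ Pointwise-All⇒All rs ps

genus-≤-by-face-count : ∀ v f g f′ g′ → v + f + 2 * g ≡ v + f′ + 2 * g′ →
  3 * f′ ≤ 3 * f + 5 → g ≤ g′
genus-≤-by-face-count v f g f′ g′ euler faces =
  <⇒≤pred (*-cancelˡ-< 6 g (suc g′) (begin-strict
    6 * g       ≤⟨ +-cancelˡ-≤ (3 * f) (6 * g) (5 + 6 * g′) tripled ⟩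
    5 + 6 * g′  <⟨ n<1+n (5 + 6 * g′) ⟩
    6 + 6 * g′  ≡⟨ *-suc 6 g′ ⟨
    6 * suc g′  ∎))
  where
  open ≤-Reasoning
  triple : ∀ f g → 3 * f + 6 * g ≡ 3 * (f + 2 * g)
  triple = solve-∀
  faces+genus : f + 2 * g ≡ f′ + 2 * g′
  faces+genus = +-cancelˡ-≡ v _ _ (trans (sym (+-assoc v f _)) (trans euler (+-assoc v f′ _)))
  tripled : 3 * f + 6 * g ≤ 3 * f + (5 + 6 * g′)
  tripled = begin
    3 * f + 6 * g         ≡⟨ triple f g ⟩
    3 * (f + 2 * g)       ≡⟨ cong (3 *_) faces+genus ⟩
    3 * (f′ + 2 * g′)     ≡⟨ triple f′ g′ ⟨
    3 * f′ + 6 * g′       ≤⟨ +-monoˡ-≤ (6 * g′) faces ⟩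
    3 * f + 5 + 6 * g′    ≡⟨ +-assoc (3 * f) 5 (6 * g′) ⟩
    3 * f + (5 + 6 * g′)  ∎

Adj-sym : ∀ {n} (G : SimpleGraph n) {u v} → Adj G u v → Adj G v u
Adj-sym G {u} {v} uv = trans (adj-sym G v u) uv

module _ {n : ℕ} {G : SimpleGraph n} where

  Digon : Rotation G → Dart n → Set
  Digon R d = iter (faceStep R) 2 d ≡ d

  ρ-fixed⇒sole-neighbour : ∀ (R : Rotation G) {v u w} → Adj G v u → ρ R v u ≡ u →
    Adj G v w → w ≡ u
  ρ-fixed⇒sole-neighbour R {v} {u} {w} vu fixed vw with k , ρᵏu≡w ← cyclic R v u w vu vw =
    trans (sym ρᵏu≡w) (iter-fixed (ρ R v) fixed k)

  -- A digon at (u , v) means that u and v both have degree 1, whatever the rotation.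
  digon-rotation-independent : ∀ (R R′ : Rotation G) {d} → IsDart G d → Digon R′ d → Digon R d
  digon-rotation-independent R R′ {u , v} uv digon = cong₂ _,_ ρvu≡u ρ[ρvu]v≡v
    where
    ρ′vu≡u : ρ R′ v u ≡ u
    ρ′vu≡u = ,-injectiveˡ digon
    ρ′uv≡v : ρ R′ u v ≡ v
    ρ′uv≡v = subst (λ z → ρ R′ z v ≡ v) ρ′vu≡u (,-injectiveʳ digon)
    ρvu≡u : ρ R v u ≡ u
    ρvu≡u = ρ-fixed⇒sole-neighbour R′ (Adj-sym G uv) ρ′vu≡u (closed R v u (Adj-sym G uv))
    ρ[ρvu]v≡v : ρ R (ρ R v u) v ≡ v
    ρ[ρvu]v≡v = trans (cong (λ z → ρ R z v) ρvu≡u)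
                      (ρ-fixed⇒sole-neighbour R′ uv ρ′uv≡v (closed R u v uv))

module FaceTracing {n : ℕ} {G : SimpleGraph n} (R : Rotation G) where

  private
    φ : Dart n → Dart n
    φ = faceStep R

  isDart-faceStep : ∀ {d} → IsDart G d → IsDart G (φ d)
  isDart-faceStep {u , v} uv = closed R v u (Adj-sym G uv)

  isDart-iter : ∀ k {d} → IsDart G d → IsDart G (iter φ k d)
  isDart-iter zero    dd = dd
  isDart-iter (suc k) dd = isDart-faceStep (isDart-iter k dd)

  dart-≢-faceStep : ∀ {d} → IsDart G d → d ≢ φ d
  dart-≢-faceStep {u , _} uv eq with refl ← ,-injectiveˡ eq with () ← trans (sym uv) (loopless G u)

  faceStep-injective : ∀ {d e} → IsDart G d → IsDart G e → φ d ≡ φ e → d ≡ e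
  faceStep-injective {u , v} {u′ , v′} uv u′v′ eq with refl ← ,-injectiveˡ eq =
    cong (_, v) (inj R v u u′ (Adj-sym G uv) (Adj-sym G u′v′) (,-injectiveʳ eq))

  iter-faceStep-injective : ∀ k {d e} → IsDart G d → IsDart G e → iter φ k d ≡ iter φ k e → d ≡ e
  iter-faceStep-injective zero    dd de eq = eq
  iter-faceStep-injective (suc k) dd de eq =
    iter-faceStep-injective k dd de
      (faceStep-injective (isDart-iter k dd) (isDart-iter k de) eq)

  dartCode : Dart n → Fin (n * n)
  dartCode (u , v) = combine u v

  dartCode-injective : ∀ {d e} → dartCode d ≡ dartCode e → d ≡ e
  dartCode-injective {u , v} {u′ , v′} eq with refl , refl ← combine-injective u v u′ v′ eq = refl

  faceStep-period : ∀ {d} → IsDart G d → ∃[ p ] 1 ≤ p × iter φ p d ≡ d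
  faceStep-period {d} dd
    with i , j , i<j , eq ← pigeonhole (n<1+n (n * n)) (λ k → dartCode (iter φ (toℕ k) d)) =
      toℕ j ∸ toℕ i , m<n⇒0<n∸m i<j ,
      sym (iter-faceStep-injective (toℕ i) dd (isDart-iter (toℕ j ∸ toℕ i) dd)
            (trans (dartCode-injective eq) (iter-∸ φ d (<⇒≤ i<j))))

  SameFace-sym : ∀ {d e} → IsDart G d → SameFace R d e → SameFace R e d
  SameFace-sym dd (k , refl) with p , 1≤p , period ← faceStep-period dd =
    k * p ∸ k , iter-inverse φ period {{>-nonZero 1≤p}} k

  SameFace-trans : ∀ {d e f} → SameFace R d e → SameFace R e f → SameFace R d f
  SameFace-trans {d} (k , refl) (l , refl) = l + k , iter-+ φ l k d

  Digon-respects-SameFace : ∀ {d e} → SameFace R d e → Digon R d → Digon R e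
  Digon-respects-SameFace {d} (k , refl) digon =
    trans (iter-comm φ 2 k d) (cong (iter φ k) digon)

  different-faces⇒disjoint : ∀ {d e} → IsDart G d → IsDart G e → ¬ SameFace R d e →
    ∀ i j → iter φ i d ≢ iter φ j e
  different-faces⇒disjoint {d} {e} dd de apart i j eq with ≤-total i j
  ... | inj₁ i≤j = apart (SameFace-sym de (j ∸ i ,
          sym (iter-faceStep-injective i dd (isDart-iter (j ∸ i) de) (trans eq (iter-∸ φ e i≤j)))))
  ... | inj₂ j≤i = apart (i ∸ j ,
          iter-faceStep-injective j (isDart-iter (i ∸ j) dd) de (trans (sym (iter-∸ φ d j≤i)) eq))

  longFace⇒¬Digon : ∀ {e l d} → IsDart G e → FaceLength R e l → 3 ≤ l →
    SameFace R e d → IsDart G d → ¬ Digon R d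
  longFace⇒¬Digon de (_ , _ , minimal) 3≤l e~d dd digon =
    minimal 2 (s≤s z≤n) 3≤l (Digon-respects-SameFace (SameFace-sym de e~d) digon)

  faceOrbit : Dart n → ℕ → List (Dart n)
  faceOrbit e l = applyUpTo (λ j → iter φ j e) l

  facesDarts : List (Dart n) → List ℕ → List (Dart n)
  facesDarts []      _        = []
  facesDarts (_ ∷ _) []       = []
  facesDarts (e ∷ L) (l ∷ ls) = faceOrbit e l ++ facesDarts L ls

  length-facesDarts : ∀ {L ls} → Pointwise (FaceLength R) L ls → length (facesDarts L ls) ≡ sum ls
  length-facesDarts [] = refl
  length-facesDarts {e ∷ L} {l ∷ ls} (_ ∷ lengths) =
    trans (length-++ (faceOrbit e l)) (cong₂ _+_ (length-applyUpTo _ l) (length-facesDarts lengths))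

  ∈-facesDarts : ∀ {L ls d} → Pointwise (FaceLength R) L ls → Any (λ e → SameFace R e d) L →
    d ∈ facesDarts L ls
  ∈-facesDarts {e ∷ _} {suc l ∷ _} ((_ , period , _) ∷ _) (here (k , refl)) =
    ∈-++⁺ˡ (subst (_∈ faceOrbit e (suc l)) (sym (iter-%-period φ period k))
                  (∈-applyUpTo⁺ (λ j → iter φ j e) (m%n<n k (suc l))))
  ∈-facesDarts {e ∷ _} {l ∷ _} (_ ∷ lengths) (there e~d) =
    ∈-++⁺ʳ (faceOrbit e l) (∈-facesDarts lengths e~d)

  threeDarts : List (Dart n) → List (Dart n)
  threeDarts []      = []
  threeDarts (e ∷ L) = e ∷ φ e ∷ φ (φ e) ∷ threeDarts L

  length-threeDarts : ∀ L → length (threeDarts L) ≡ 3 * length L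
  length-threeDarts []      = refl
  length-threeDarts (_ ∷ L) = trans (cong (3 +_) (length-threeDarts L)) (sym (*-suc 3 (length L)))

  All-threeDarts : ∀ {P : Dart n → Set} {L} → All (λ e → ∀ j → P (iter φ j e)) L →
    All P (threeDarts L)
  All-threeDarts []       = []
  All-threeDarts (p ∷ ps) = p 0 ∷ p 1 ∷ p 2 ∷ All-threeDarts ps

  threeDarts-unique : (∀ {d} → IsDart G d → ¬ Digon R d) → ∀ {L} → All (IsDart G) L →
    AllPairs (λ d e → ¬ SameFace R d e) L → Unique (threeDarts L)
  threeDarts-unique noDigon []         []           = []
  threeDarts-unique noDigon (de ∷ des) (apart ∷ apartL) =
      (dart-≢-faceStep de ∷ (λ eq → noDigon de (sym eq)) ∷ disjointFrom 0)
    ∷ (dart-≢-faceStep (isDart-faceStep de) ∷ disjointFrom 1)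
    ∷ disjointFrom 2
    ∷ threeDarts-unique noDigon des apartL
    where
    disjointFrom : ∀ i → All (iter φ i _ ≢_) (threeDarts _)
    disjointFrom i = All-threeDarts (All.zipWith
      (λ (de′ , apart′) j → different-faces⇒disjoint de de′ apart′ i j) (des , apart))

  three-darts-per-face : (∀ {d} → IsDart G d → ¬ Digon R d) → ∀ {L D} → FaceReps R L →
    (∀ {d} → IsDart G d → d ∈ D) → 3 * length L ≤ length D
  three-darts-per-face noDigon {L} (darts , apart , _) allDarts =
    subst (_≤ _) (length-threeDarts L)
      (Unique-⊆⇒length-≤ (threeDarts-unique noDigon darts apart)
        (λ d∈ → allDarts (All.lookup (All-threeDarts (All.map (λ de j → isDart-iter j de) darts)) d∈)))

  faceReps-length-≤ : ∀ {L L₁} → FaceReps R L → FaceReps R L₁ → length L ≤ length L₁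
  faceReps-length-≤ (darts , apart , _) (darts₁ , _ , covers₁) =
    length-≤-of-separated-witnesses (λ d e → SameFace R e d)
      (AllPairs.map (λ apart′ {_} e∈L₁ e~d e~d′ →
         apart′ (SameFace-trans (SameFace-sym (All.lookup darts₁ e∈L₁) e~d) e~d′)) apart)
      (All.map (λ {d} → covers₁ d) darts)

  longFaces⇒¬Digon : ∀ {L ls} → FaceReps R L → Pointwise (FaceLength R) L ls → All (3 ≤_) ls →
    ∀ {d} → IsDart G d → ¬ Digon R d
  longFaces⇒¬Digon (darts , _ , covers) lengths long dd
    with (de , _ , fl , 3≤l) , e~d ←
           All.lookupAny (All.zip (darts , Pointwise-All⇒All lengths long)) (covers _ dd) =
      longFace⇒¬Digon de fl 3≤l e~d dd

  darts⊆facesDarts : ∀ {L ls} → FaceReps R L → Pointwise (FaceLength R) L ls →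
    ∀ {d} → IsDart G d → d ∈ facesDarts L ls
  darts⊆facesDarts (_ , _ , covers) lengths dd = ∈-facesDarts lengths (covers _ dd)

open FaceTracing

mainTheorem3 : ∀ {n : ℕ} (G : SimpleGraph n) → 2 ≤ n → Connected G
    → (R : Rotation G) → TypeExcessAtMost R 5 → MinimumGenus R
mainTheorem3 {n} G _ _ R (L , ls , reps , lengths , long , excess) g R′ g′
  (_ , (L₁ , reps₁ , refl) , euler) (_ , (L′ , reps′ , refl) , euler′) =
  genus-≤-by-face-count n (length L₁) g (length L′) g′ (trans euler (sym euler′)) (begin
    3 * length L′
      ≤⟨ three-darts-per-face R′ noDigon′ reps′ (darts⊆facesDarts R reps lengths) ⟩
    length (facesDarts R L ls)
      ≡⟨ length-facesDarts R lengths ⟩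
    sum ls
      ≡⟨ sum-excess 3 ls long ⟩
    3 * length ls + sum (map (_∸ 3) ls)
      ≤⟨ +-monoʳ-≤ (3 * length ls) excess ⟩
    3 * length ls + 5
      ≡⟨ cong (λ m → 3 * m + 5) (Pointwise-length lengths) ⟨
    3 * length L + 5
      ≤⟨ +-monoˡ-≤ 5 (*-monoʳ-≤ 3 (faceReps-length-≤ R reps reps₁)) ⟩
    3 * length L₁ + 5
      ∎)
  where
  open ≤-Reasoning
  noDigon′ : ∀ {d} → IsDart G d → ¬ Digon R′ d
  noDigon′ dd = longFaces⇒¬Digon R reps lengths long dd ∘ digon-rotation-independent R R′ dd
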